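{- Let $\ell$ be a positive integer and consider $\mathbb Z^\ell$ with the metric $d(a,b)=\sum_{i=1}^\ell|a_i-b_i|$ (the graph metric of the $\ell$-dimensional lattice graph). There is a positive constant $c_\ell$ such that for every positive integer $n$, $$\mu_n(\mathbb Z^\ell)\geq c_\ell\, n^{3-\frac1\ell}.$$
   Context: For a metric space $(M,d_M)$, a triple $(a,b,c)\in M^3$ is a 3-term arithmetic progression if $d_M(a,b)=d_M(b,c)=\frac12 d_M(a,c)$ (constant triples included). For finite $A\subseteq M$, $\mathrm{AP}_3(M;A)$ is the set of such triples in $A^3$, and $\mu_n(M):=\max\{|\mathrm{AP}_3(M;A)| : A\subseteq M,\ |A|=n\}$. -}

module Defs where

open import Data.Nat using (ℕ; _+_; _*_)
open import Data.Nat.Properties using (_≟_)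
open import Data.Integer as ℤ using (ℤ; ∣_∣; _-_)
open import Data.Vec using (Vec; zipWith; foldr)
open import Data.List using (List; _∷_; []; filter; length; concatMap; map)
open import Data.Product using (_×_; _,_)
open import Relation.Binary.PropositionalEquality using (_≡_)
open import Relation.Nullary using (Dec)
open import Relation.Nullary.Decidable using (_×-dec_)

Point : ℕ → Set
Point ℓ = Vec ℤ ℓ

dist : ∀ {ℓ} → Point ℓ → Point ℓ → ℕ
dist a b = foldr (λ _ → ℕ) _+_ 0 (zipWith (λ x y → ∣ x - y ∣) a b)

-- (a,b,c) is a 3-term AP: d(a,b) = d(b,c) = d(a,c)/2,
-- written without division as 2·d(a,b) = d(a,c) and 2·d(b,c) = d(a,c).
IsAP3 : ∀ {ℓ} → Point ℓ × Point ℓ × Point ℓ → Set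
IsAP3 (a , b , c) = (2 * dist a b ≡ dist a c) × (2 * dist b c ≡ dist a c)

isAP3? : ∀ {ℓ} (t : Point ℓ × Point ℓ × Point ℓ) → Dec (IsAP3 t)
isAP3? (a , b , c) = (2 * dist a b ≟ dist a c) ×-dec (2 * dist b c ≟ dist a c)

triples : ∀ {X : Set} → List X → List (X × X × X)
triples A = concatMap (λ a → concatMap (λ b → map (λ c → (a , b , c)) A) A) A

-- |AP₃(ℤ^ℓ; A)| for a finite set A given as a duplicate-free list
ap3Count : ∀ {ℓ} → List (Point ℓ) → ℕ
ap3Count A = length (filter isAP3? (triples A))

-- If three lattice points are increasing in every coordinate, their ℓ¹ distances are
-- the differences of their coordinate sums, so they form a 3-term progression as soon
-- as those sums are equally spaced. On the line, 0 ≤ a < m ≤ b < 2m and c = 2b − a give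
-- m² progressions inside {0, …, 4m − 1}, which is of order n^(3 − 1/ℓ) for ℓ = 1. For
-- ℓ ≥ 2 place the n points, with distinct first coordinates, on three anti-diagonal
-- segments x + y = n, 2n, 3n following each other in x, with m points on each of the
-- first two and at least m on the third. The segments are chained coordinatewise, so
-- every choice of one point per segment is a progression: m³ of them, and
-- n³ ≥ n^(3 − 1/ℓ). Taking m = ⌊n/4⌋ resp. ⌊n/3⌋ loses only a constant factor, because
-- the constant progressions make the count positive.

module Submission where

open import Data.Bool using (if_then_else_)
open import Data.Empty using (⊥-elim; ⊥-elim-irr)
open import Data.Integer as ℤ using (∣_∣)
import Data.Integer.Properties as ℤ
open import Data.List
  using (List; []; _∷_; _++_; length; map; filter; upTo; cartesianProductWith; cartesianProduct)
open import Data.List.Properties using (length-++; length-map; length-upTo)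
open import Data.List.Membership.Propositional using (_∈_)
open import Data.List.Membership.Propositional.Properties
  using ( ∈-map⁺; ∈-map⁻; ∈-upTo⁺; ∈-upTo⁻; ∈-concatMap⁺; ∈-filter⁺; ∈-++⁻; ∈-++⁺ˡ; ∈-++⁺ʳ; ∈-∃++
        ; ∈-cartesianProductWith⁻; ∈-cartesianProduct⁻)
open import Data.List.Relation.Binary.Subset.Propositional using (_⊆_)
import Data.List.Relation.Unary.All as All
open import Data.List.Relation.Unary.Any as Any using (here; there)
open import Data.List.Relation.Unary.Unique.Propositional using (Unique; []; _∷_)
import Data.List.Relation.Unary.Unique.Propositional.Properties as Unique
open import Data.Nat using (ℕ; zero; suc; _+_; _*_; _^_; _∸_; _≤_; _<_; NonZero; >-nonZero⁻¹; z≤n; s≤s)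
open import Data.Nat.DivMod using (_/_; _%_; m≡m%n+[m/n]*n; m%n<n; m/n*n≤m)
open import Data.Nat.Properties
open import Algebra.Properties.CommutativeSemigroup +-commutativeSemigroup
  using (interchange; xy∙z≈xz∙y)
open import Algebra.Properties.CommutativeSemigroup *-commutativeSemigroup
  using () renaming (interchange to *-interchange)
open import Data.Nat.Solver using (module +-*-Solver)
open +-*-Solver using (solve; _:+_; _:*_; _:=_; con)
open import Data.Product using (Σ; _×_; _,_; proj₁; proj₂)
open import Data.Sum using (inj₁; inj₂)
open import Data.Vec as Vec using (Vec; _∷_; []; sum)
open import Data.Vec.Relation.Binary.Pointwise.Inductive as Pointwise using (Pointwise; _∷_; [])
open import Relation.Binary.PropositionalEquality
open import Relation.Nullary.Decidable using (does; dec-true; dec-false)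

open import Defs

private
  variable
    A B C : Set
    ℓ : ℕ

unique-⊆⇒length≤ : {xs ys : List A} → Unique xs → xs ⊆ ys → length xs ≤ length ys
unique-⊆⇒length≤ [] _ = z≤n
unique-⊆⇒length≤ {xs = x ∷ xs} (x∉xs ∷ !xs) x∷xs⊆ys with ∈-∃++ (x∷xs⊆ys (here refl))
... | ys₁ , ys₂ , refl = begin
  suc (length xs)                ≤⟨ s≤s (unique-⊆⇒length≤ !xs xs⊆ys₁ys₂) ⟩
  suc (length (ys₁ ++ ys₂))      ≡⟨ cong suc (length-++ ys₁) ⟩
  suc (length ys₁ + length ys₂)  ≡⟨ sym (+-suc (length ys₁) (length ys₂)) ⟩
  length ys₁ + suc (length ys₂)  ≡⟨ sym (length-++ ys₁) ⟩
  length (ys₁ ++ x ∷ ys₂)        ∎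
  where
  open ≤-Reasoning
  xs⊆ys₁ys₂ : xs ⊆ ys₁ ++ ys₂
  xs⊆ys₁ys₂ {y} y∈xs with ∈-++⁻ ys₁ (x∷xs⊆ys (there y∈xs))
  ... | inj₁ y∈ys₁         = ∈-++⁺ˡ y∈ys₁
  ... | inj₂ (here refl)   = ⊥-elim (All.lookup x∉xs y∈xs refl)
  ... | inj₂ (there y∈ys₂) = ∈-++⁺ʳ ys₁ y∈ys₂

length-cartesianProductWith : (f : A → B → C) (xs : List A) (ys : List B) →
  length (cartesianProductWith f xs ys) ≡ length xs * length ys
length-cartesianProductWith f [] ys = refl
length-cartesianProductWith f (x ∷ xs) ys = begin
  length (map (f x) ys ++ cartesianProductWith f xs ys)
    ≡⟨ length-++ (map (f x) ys) ⟩
  length (map (f x) ys) + length (cartesianProductWith f xs ys)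
    ≡⟨ cong₂ _+_ (length-map (f x) ys) (length-cartesianProductWith f xs ys) ⟩
  length ys + length xs * length ys
    ∎
  where open ≡-Reasoning

range : ℕ → ℕ → List ℕ
range s k = map (s +_) (upTo k)

range-unique : ∀ s k → Unique (range s k)
range-unique s k = Unique.map⁺ (+-cancelˡ-≡ s _ _) (Unique.upTo⁺ k)

length-range : ∀ s k → length (range s k) ≡ k
length-range s k = trans (length-map (s +_) (upTo k)) (length-upTo k)

∈-range⁻ : ∀ {s k x} → x ∈ range s k → s ≤ x × x < s + k
∈-range⁻ {s} x∈ with ∈-map⁻ (s +_) x∈
... | i , i∈upTo , refl = m≤m+n s i , +-monoʳ-< s (∈-upTo⁻ i∈upTo)

^-distrib-* : ∀ m n e → (m * n) ^ e ≡ m ^ e * n ^ e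
^-distrib-* m n zero    = refl
^-distrib-* m n (suc e) = trans (cong (m * n *_) (^-distrib-* m n e)) (*-interchange m n (m ^ e) (n ^ e))

[1+m]^e≤2^e*c : ∀ {m c} e → 1 ≤ c → m ^ e ≤ c → suc m ^ e ≤ 2 ^ e * c
[1+m]^e≤2^e*c {zero} {c} e 1≤c _ = begin
  1 ^ e      ≡⟨ ^-zeroˡ e ⟩
  1          ≤⟨ *-mono-≤ (m^n>0 2 e) 1≤c ⟩
  2 ^ e * c  ∎
  where open ≤-Reasoning
[1+m]^e≤2^e*c {m@(suc _)} {c} e _ m^e≤c = begin
  suc m ^ e      ≤⟨ ^-monoˡ-≤ e (≤-trans (+-monoˡ-≤ m (s≤s z≤n)) (≤-reflexive m+m≡2*m)) ⟩
  (2 * m) ^ e    ≡⟨ ^-distrib-* 2 m e ⟩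
  2 ^ e * m ^ e  ≤⟨ *-monoʳ-≤ (2 ^ e) m^e≤c ⟩
  2 ^ e * c      ∎
  where
  open ≤-Reasoning
  m+m≡2*m : m + m ≡ 2 * m
  m+m≡2*m = cong (m +_) (sym (+-identityʳ m))

n^e≤[2d]^e*c : ∀ {n d m c} e → n < d * suc m → 1 ≤ c → m ^ e ≤ c → n ^ e ≤ (2 * d) ^ e * c
n^e≤[2d]^e*c {n} {d} {m} {c} e n<d[1+m] 1≤c m^e≤c = begin
  n ^ e                ≤⟨ ^-monoˡ-≤ e (<⇒≤ n<d[1+m]) ⟩
  (d * suc m) ^ e      ≡⟨ ^-distrib-* d (suc m) e ⟩
  d ^ e * suc m ^ e    ≤⟨ *-monoʳ-≤ (d ^ e) ([1+m]^e≤2^e*c e 1≤c m^e≤c) ⟩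
  d ^ e * (2 ^ e * c)  ≡⟨ sym (*-assoc (d ^ e) (2 ^ e) c) ⟩
  d ^ e * 2 ^ e * c    ≡⟨ cong (_* c) (trans (*-comm (d ^ e) (2 ^ e)) (sym (^-distrib-* 2 d e))) ⟩
  (2 * d) ^ e * c      ∎
  where open ≤-Reasoning

m<n*[1+m/n] : ∀ m n .{{_ : NonZero n}} → m < n * suc (m / n)
m<n*[1+m/n] m n = begin-strict
  m                  ≡⟨ m≡m%n+[m/n]*n m n ⟩
  m % n + m / n * n  <⟨ +-monoˡ-< (m / n * n) (m%n<n m n) ⟩
  suc (m / n) * n    ≡⟨ *-comm (suc (m / n)) n ⟩
  n * suc (m / n)    ∎
  where open ≤-Reasoning

n*[m/n]≤m : ∀ m n .{{_ : NonZero n}} → n * (m / n) ≤ m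
n*[m/n]≤m m n = ≤-trans (≤-reflexive (*-comm n (m / n))) (m/n*n≤m m n)

1^ℓ*n^k≤c^ℓ : ∀ ℓ e {n c k} .{{_ : NonZero n}} → k ≤ e * ℓ → n ^ e ≤ c → 1 ^ ℓ * n ^ k ≤ c ^ ℓ
1^ℓ*n^k≤c^ℓ ℓ e {n} {c} {k} k≤eℓ n^e≤c = begin
  1 ^ ℓ * n ^ k  ≡⟨ trans (cong (_* n ^ k) (^-zeroˡ ℓ)) (*-identityˡ (n ^ k)) ⟩
  n ^ k          ≤⟨ ^-monoʳ-≤ n k≤eℓ ⟩
  n ^ (e * ℓ)    ≡⟨ sym (^-*-assoc n e ℓ) ⟩
  (n ^ e) ^ ℓ    ≤⟨ ^-monoˡ-≤ ℓ n^e≤c ⟩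
  c ^ ℓ          ∎
  where open ≤-Reasoning

AP₃ : List (Point ℓ) → List (Point ℓ × Point ℓ × Point ℓ)
AP₃ A = filter isAP3? (triples A)

∈-AP₃⁺ : {A : List (Point ℓ)} {a b c : Point ℓ} → a ∈ A → b ∈ A → c ∈ A →
  IsAP3 (a , b , c) → (a , b , c) ∈ AP₃ A
∈-AP₃⁺ {A = A} {a} {b} {c} a∈A b∈A c∈A = ∈-filter⁺ isAP3? ∈-triples
  where
  ∈-triples : (a , b , c) ∈ triples A
  ∈-triples = ∈-concatMap⁺ _ (Any.map (λ { refl →
                ∈-concatMap⁺ _ (Any.map (λ { refl → ∈-map⁺ _ c∈A }) b∈A) }) a∈A)

isAP3-of-dist : {a b c : Point ℓ} (t : ℕ) → dist a b ≡ t → dist b c ≡ t → dist a c ≡ t + t →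
  IsAP3 (a , b , c)
isAP3-of-dist {a = a} {c = c} t ab bc ac = twice ab , twice bc
  where
  twice : ∀ {d} → d ≡ t → 2 * d ≡ dist a c
  twice refl = trans (cong (t +_) (+-identityʳ t)) (sym ac)

dist-self : (a : Point ℓ) → dist a a ≡ 0
dist-self [] = refl
dist-self (x ∷ a) = cong₂ _+_ (cong ∣_∣ (ℤ.+-inverseʳ x)) (dist-self a)

isAP3-constant : (a : Point ℓ) → IsAP3 (a , a , a)
isAP3-constant a = isAP3-of-dist {a = a} {a} {a} 0 (dist-self a) (dist-self a) (dist-self a)

∈⇒1≤ap3Count : {A : List (Point ℓ)} {a : Point ℓ} → a ∈ A → 1 ≤ ap3Count A
∈⇒1≤ap3Count {a = a} a∈A =
  unique-⊆⇒length≤ (All.[] ∷ []) λ { (here refl) → ∈-AP₃⁺ a∈A a∈A a∈A (isAP3-constant a) }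

embed : Vec ℕ ℓ → Point ℓ
embed = Vec.map (λ x → ℤ.+ x)

∣+m-+n∣≡n∸m : ∀ {m n} → m ≤ n → ∣ ℤ.+ m ℤ.- ℤ.+ n ∣ ≡ n ∸ m
∣+m-+n∣≡n∸m {m} {n} m≤n = trans (cong ∣_∣ (ℤ.m-n≡m⊖n m n)) (ℤ.∣⊖∣-≤ m≤n)

sum+dist-embed : {u v : Vec ℕ ℓ} → Pointwise _≤_ u v → sum u + dist (embed u) (embed v) ≡ sum v
sum+dist-embed [] = refl
sum+dist-embed {u = x ∷ u} {y ∷ v} (x≤y ∷ u≤v) = begin
  (x + sum u) + (∣ ℤ.+ x ℤ.- ℤ.+ y ∣ + dist (embed u) (embed v))
    ≡⟨ cong (λ d → x + sum u + (d + _)) (∣+m-+n∣≡n∸m x≤y) ⟩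
  (x + sum u) + ((y ∸ x) + dist (embed u) (embed v))
    ≡⟨ interchange x (sum u) (y ∸ x) _ ⟩
  (x + (y ∸ x)) + (sum u + dist (embed u) (embed v))
    ≡⟨ cong₂ _+_ (m+[n∸m]≡n x≤y) (sum+dist-embed u≤v) ⟩
  y + sum v
    ∎
  where open ≡-Reasoning

isAP3-embed : {u v w : Vec ℕ ℓ} (t : ℕ) → Pointwise _≤_ u v → Pointwise _≤_ v w →
  sum v ≡ sum u + t → sum w ≡ sum v + t → IsAP3 (embed u , embed v , embed w)
isAP3-embed {u = u} {v} {w} t u≤v v≤w Σv Σw = isAP3-of-dist {a = embed u} {embed v} {embed w} t
  (+-cancelˡ-≡ (sum u) _ _ (trans (sum+dist-embed u≤v) Σv))
  (+-cancelˡ-≡ (sum v) _ _ (trans (sum+dist-embed v≤w) Σw))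
  (+-cancelˡ-≡ (sum u) _ _ (begin
    sum u + dist (embed u) (embed w) ≡⟨ sum+dist-embed (Pointwise.trans ≤-trans u≤v v≤w) ⟩
    sum w                            ≡⟨ trans Σw (cong (_+ t) Σv) ⟩
    sum u + t + t                    ≡⟨ +-assoc (sum u) t t ⟩
    sum u + (t + t)                  ∎))
  where open ≡-Reasoning

image : (ℕ → Point ℓ) → ℕ → List (Point ℓ)
image pt n = map pt (upTo n)

length-image : (pt : ℕ → Point ℓ) (n : ℕ) → length (image pt n) ≡ n
length-image pt n = trans (length-map pt (upTo n)) (length-upTo n)

∈-image⁺ : {pt : ℕ → Point ℓ} {n x : ℕ} → x < n → pt x ∈ image pt n
∈-image⁺ {pt = pt} x<n = ∈-map⁺ pt (∈-upTo⁺ x<n)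

1≤ap3Count-image : (pt : ℕ → Point ℓ) (n : ℕ) .{{_ : NonZero n}} → 1 ≤ ap3Count (image pt n)
1≤ap3Count-image pt n = ∈⇒1≤ap3Count (∈-image⁺ {pt = pt} (>-nonZero⁻¹ n))

module _ {pt : ℕ → Point ℓ} (pt-injective : ∀ {x y} → pt x ≡ pt y → x ≡ y) where

  image-unique : ∀ n → Unique (image pt n)
  image-unique n = Unique.map⁺ pt-injective (Unique.upTo⁺ n)

  length≤ap3Count-image : ∀ n (T : List (ℕ × ℕ × ℕ)) → Unique T →
    (∀ {x y z} → (x , y , z) ∈ T → x < n × y < n × z < n × IsAP3 (pt x , pt y , pt z)) →
    length T ≤ ap3Count (image pt n)
  length≤ap3Count-image n T T-unique good = begin
    length T           ≡⟨ sym (length-map pt³ T) ⟩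
    length (map pt³ T) ≤⟨ unique-⊆⇒length≤ (Unique.map⁺ pt³-injective T-unique) pt³[T]⊆AP₃ ⟩
    ap3Count (image pt n) ∎
    where
    open ≤-Reasoning
    pt³ : ℕ × ℕ × ℕ → Point ℓ × Point ℓ × Point ℓ
    pt³ (x , y , z) = pt x , pt y , pt z
    pt³-injective : ∀ {s t} → pt³ s ≡ pt³ t → s ≡ t
    pt³-injective e
      with refl ← pt-injective (cong proj₁ e)
         | refl ← pt-injective (cong (λ t → proj₁ (proj₂ t)) e)
         | refl ← pt-injective (cong (λ t → proj₂ (proj₂ t)) e) = refl
    pt³[T]⊆AP₃ : map pt³ T ⊆ AP₃ (image pt n)
    pt³[T]⊆AP₃ p∈ with ∈-map⁻ pt³ p∈
    ... | _ , xyz∈T , refl with good xyz∈T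
    ... | x<n , y<n , z<n , ap = ∈-AP₃⁺ (∈-image⁺ x<n) (∈-image⁺ y<n) (∈-image⁺ z<n) ap


onLine : ℕ → Point 1
onLine x = embed (x ∷ [])

onLine-injective : ∀ {x y} → onLine x ≡ onLine y → x ≡ y
onLine-injective e = ℤ.+-injective (cong Vec.head e)

isAP3-onLine : ∀ {i j} → i ≤ j → IsAP3 (onLine i , onLine j , onLine (j + (j ∸ i)))
isAP3-onLine {i} {j} i≤j = isAP3-embed (j ∸ i) (i≤j ∷ []) (m≤m+n j (j ∸ i) ∷ [])
  (trans (+-identityʳ j) (trans (sym (m+[n∸m]≡n i≤j)) (cong (_+ (j ∸ i)) (sym (+-identityʳ i)))))
  (trans (+-identityʳ _) (cong (_+ (j ∸ i)) (sym (+-identityʳ j))))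

m^2≤ap3Count-line : ∀ {m n} → 4 * m ≤ n → m ^ 2 ≤ ap3Count (image onLine n)
m^2≤ap3Count-line {m} {n} 4m≤n = begin
  m ^ 2     ≡⟨ cong (m *_) (*-identityʳ m) ⟩
  m * m     ≡⟨ sym length-T ⟩
  length T  ≤⟨ length≤ap3Count-image onLine-injective n T T-unique in-range-progression ⟩
  ap3Count (image onLine n) ∎
  where
  open ≤-Reasoning
  progression : ℕ → ℕ → ℕ × ℕ × ℕ
  progression i j = i , j , j + (j ∸ i)
  T : List (ℕ × ℕ × ℕ)
  T = cartesianProductWith progression (range 0 m) (range m m)
  length-T : length T ≡ m * m
  length-T = trans (length-cartesianProductWith progression (range 0 m) (range m m))
                   (cong₂ _*_ (length-range 0 m) (length-range m m))
  T-unique : Unique T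
  T-unique = Unique.cartesianProductWith⁺ progression
    (λ e → cong proj₁ e , cong (λ t → proj₁ (proj₂ t)) e) (range-unique 0 m) (range-unique m m)
  in-range-progression : ∀ {x y z} → (x , y , z) ∈ T →
    x < n × y < n × z < n × IsAP3 (onLine x , onLine y , onLine z)
  in-range-progression p∈ with ∈-cartesianProductWith⁻ progression (range 0 m) (range m m) p∈
  ... | i , j , i∈ , j∈ , refl with ∈-range⁻ i∈ | ∈-range⁻ j∈
  ... | _ , i<m | m≤j , j<2m = <-trans i<j j<n , j<n , z<n , isAP3-onLine (<⇒≤ i<j)
    where
    i<j : i < j
    i<j = <-≤-trans i<m m≤j
    z<n : j + (j ∸ i) < n
    z<n = begin-strict
      j + (j ∸ i)        ≤⟨ +-monoʳ-≤ j (m∸n≤m j i) ⟩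
      j + j              <⟨ +-mono-< j<2m j<2m ⟩
      (m + m) + (m + m)  ≡⟨ solve 1 (λ m → (m :+ m) :+ (m :+ m) := con 4 :* m) refl m ⟩
      4 * m              ≤⟨ 4m≤n ⟩
      n                  ∎
    j<n : j < n
    j<n = ≤-<-trans (m≤m+n j (j ∸ i)) z<n

stair : ∀ {z} → Vec ℕ z → ℕ → ℕ → Vec ℕ (suc (suc z))
stair rest L x = x ∷ L ∸ x ∷ rest

sum-stair : ∀ {z} (rest : Vec ℕ z) {L x} → x ≤ L → sum (stair rest L x) ≡ L + sum rest
sum-stair rest {L} {x} x≤L =
  trans (sym (+-assoc x (L ∸ x) (sum rest))) (cong (_+ sum rest) (m+[n∸m]≡n x≤L))

stair-≤ : ∀ {z} (rest : Vec ℕ z) {L n x y} → x ≤ y → y ≤ n →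
  Pointwise _≤_ (stair rest L x) (stair rest (L + n) y)
stair-≤ rest {L} {n} {x} x≤y y≤n =
  x≤y ∷ ≤-trans (m∸n≤m L x) (m+n≤o⇒m≤o∸n L (+-monoʳ-≤ L y≤n)) ∷ Pointwise.refl ≤-refl

isAP3-stair : ∀ {z} (rest : Vec ℕ z) {L n x y h} → x ≤ L → x ≤ y → y ≤ h → y ≤ n → h ≤ n →
  IsAP3 (embed (stair rest L x) , embed (stair rest (L + n) y) , embed (stair rest (L + n + n) h))
isAP3-stair rest {L} {n} x≤L x≤y y≤h y≤n h≤n =
  isAP3-embed n (stair-≤ rest x≤y y≤n) (stair-≤ rest y≤h h≤n)
    (sum-stair-step x≤L y≤n) (sum-stair-step (≤-trans y≤n (m≤n+m n L)) h≤n)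
  where
  sum-stair-step : ∀ {L' x' y'} → x' ≤ L' → y' ≤ n →
    sum (stair rest (L' + n) y') ≡ sum (stair rest L' x') + n
  sum-stair-step {L'} {x'} {y'} x'≤L' y'≤n = begin
    sum (stair rest (L' + n) y')  ≡⟨ sum-stair rest (≤-trans y'≤n (m≤n+m n L')) ⟩
    L' + n + sum rest             ≡⟨ xy∙z≈xz∙y L' n (sum rest) ⟩
    L' + sum rest + n             ≡⟨ cong (_+ n) (sym (sum-stair rest x'≤L')) ⟩
    sum (stair rest L' x') + n    ∎
    where open ≡-Reasoning

module Staircase (z k n : ℕ) where

  level : ℕ → ℕ
  level x = if does (x <? k) then n else if does (x <? k + k) then n + n else n + n + n

  level-low : ∀ {x} → x < k → level x ≡ n
  level-low {x} x<k rewrite dec-true (x <? k) x<k = refl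

  level-mid : ∀ {x} → k ≤ x → x < k + k → level x ≡ n + n
  level-mid {x} k≤x x<2k rewrite dec-false (x <? k) (≤⇒≯ k≤x) | dec-true (x <? k + k) x<2k = refl

  level-high : ∀ {x} → k + k ≤ x → level x ≡ n + n + n
  level-high {x} 2k≤x
    rewrite dec-false (x <? k) (≤⇒≯ (≤-trans (m≤m+n k k) 2k≤x)) | dec-false (x <? k + k) (≤⇒≯ 2k≤x) = refl

  point : ℕ → Point (suc (suc z))
  point x = embed (stair (Vec.replicate z 0) (level x) x)

  point-injective : ∀ {x y} → point x ≡ point y → x ≡ y
  point-injective e = ℤ.+-injective (cong Vec.head e)

  k^3≤ap3Count-staircase : 3 * k ≤ n → k ^ 3 ≤ ap3Count (image point n)
  k^3≤ap3Count-staircase 3k≤n = begin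
    k ^ 3             ≡⟨ cong (λ t → k * (k * t)) (*-identityʳ k) ⟩
    k * (k * k)       ≡⟨ sym length-T ⟩
    length T          ≤⟨ length≤ap3Count-image point-injective n T T-unique in-blocks ⟩
    ap3Count (image point n) ∎
    where
    open ≤-Reasoning
    T : List (ℕ × ℕ × ℕ)
    T = cartesianProduct (range 0 k) (cartesianProduct (range k k) (range (k + k) k))
    length-T : length T ≡ k * (k * k)
    length-T = trans (length-cartesianProductWith _,_ (range 0 k) _)
      (cong₂ _*_ (length-range 0 k) (trans (length-cartesianProductWith _,_ (range k k) _)
                                            (cong₂ _*_ (length-range k k) (length-range (k + k) k))))
    T-unique : Unique T
    T-unique = Unique.cartesianProduct⁺ (range-unique 0 k)
                 (Unique.cartesianProduct⁺ (range-unique k k) (range-unique (k + k) k))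
    k+k+k≡3k : k + k + k ≡ 3 * k
    k+k+k≡3k = solve 1 (λ k → k :+ k :+ k := con 3 :* k) refl k
    in-blocks : ∀ {x y h} → (x , y , h) ∈ T →
      x < n × y < n × h < n × IsAP3 (point x , point y , point h)
    in-blocks {x} {y} {h} xyh∈
      with x∈ , yh∈ ← ∈-cartesianProduct⁻ (range 0 k) _ xyh∈
      with y∈ , h∈ ← ∈-cartesianProduct⁻ (range k k) (range (k + k) k) yh∈
      with _ , x<k ← ∈-range⁻ x∈ | k≤y , y<2k ← ∈-range⁻ y∈ | 2k≤h , h<3k ← ∈-range⁻ h∈
      = x<n , y<n , h<n , ap
      where
      h<n : h < n
      h<n = <-≤-trans h<3k (≤-trans (≤-reflexive k+k+k≡3k) 3k≤n)
      y<n : y < n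
      y<n = <-trans (<-≤-trans y<2k 2k≤h) h<n
      x<n : x < n
      x<n = <-trans (<-≤-trans x<k k≤y) y<n
      ap : IsAP3 (point x , point y , point h)
      ap rewrite level-low x<k | level-mid k≤y y<2k | level-high 2k≤h =
        isAP3-stair (Vec.replicate z 0) (<⇒≤ x<n) (<⇒≤ (<-≤-trans x<k k≤y))
          (<⇒≤ (<-≤-trans y<2k 2k≤h)) (<⇒≤ y<n) (<⇒≤ h<n)

n^2≤64*ap3Count-line : ∀ n .{{_ : NonZero n}} → n ^ 2 ≤ 64 * ap3Count (image onLine n)
n^2≤64*ap3Count-line n = n^e≤[2d]^e*c {d = 4} {m = n / 4} 2 (m<n*[1+m/n] n 4)
  (1≤ap3Count-image onLine n) (m^2≤ap3Count-line {n / 4} (n*[m/n]≤m n 4))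

n^3≤216*ap3Count-staircase : ∀ z n .{{_ : NonZero n}} →
  n ^ 3 ≤ 216 * ap3Count (image (Staircase.point z (n / 3) n) n)
n^3≤216*ap3Count-staircase z n = n^e≤[2d]^e*c {d = 3} {m = n / 3} 3 (m<n*[1+m/n] n 3)
  (1≤ap3Count-image point n) (k^3≤ap3Count-staircase (n*[m/n]≤m n 3))
  where open Staircase z (n / 3) n

proposition5p2 : (ℓ : ℕ) → .{{_ : NonZero ℓ}} →
    Σ ℕ λ p → Σ ℕ λ q → NonZero p × NonZero q ×
      ((n : ℕ) → .{{_ : NonZero n}} →
        Σ (List (Point ℓ)) λ A → Unique A × length A ≡ n ×
          (p ^ ℓ * n ^ (3 * ℓ ∸ 1) ≤ (q * ap3Count A) ^ ℓ))
proposition5p2 zero {{ℓ≢0}} = ⊥-elim-irr (NonZero.nonZero ℓ≢0)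
proposition5p2 1 = 1 , 64 , _ , _ , λ n →
  image onLine n , image-unique onLine-injective n , length-image onLine n ,
  1^ℓ*n^k≤c^ℓ 1 2 ≤-refl (n^2≤64*ap3Count-line n)
proposition5p2 ℓ@(suc (suc z)) = 1 , 216 , _ , _ , λ n → let open Staircase z (n / 3) n in
  image point n , image-unique point-injective n , length-image point n ,
  1^ℓ*n^k≤c^ℓ ℓ 3 (m∸n≤m (3 * ℓ) 1) (n^3≤216*ap3Count-staircase z n)
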